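{- Let $n,k$ be nonnegative integers with expansions in base $\mathbf{F}$ given by $(n)_{\mathbf F}=(n_i)_{i\ge 0}$ and $(k)_{\mathbf F}=(k_i)_{i\ge 0}$. Then $$\binom{n}{k}_F\equiv \binom{n_0}{k_0}_F\binom{n_1}{k_1}_F\binom{n_2}{k_2}_F\cdots \pmod 2.$$
   Context: The Fibonacci numbers are defined by $F_0=0$, $F_1=1$, $F_n=F_{n-1}+F_{n-2}$ for $n\ge 2$; $n!_F=F_1\cdots F_n$ ($0!_F=1$) and $\binom{n}{k}_F=\frac{n!_F}{k!_F(n-k)!_F}$ for $0\le k\le n$, with $\binom{n}{k}_F=0$ for $k<0$ or $k>n$. For an increasing sequence $\mathbf b=(b_0,b_1,\ldots)$ of positive integers with $b_0=1$ and $b_{i-1}\mid b_i$ for $i\ge1$, the expansion of $n$ in base $\mathbf b$ is the unique sequence $(n)_{\mathbf b}=(n_0,n_1,\ldots)$ with $n=\sum_i n_ib_i$ and $0\le n_i<b_{i+1}/b_i$ for all $i$. The base $\mathbf F$ is $\mathbf F=(1,3,3\cdot2,3\cdot 2^2,3\cdot2^3,\ldots)$, so $n_0\in\{0,1,2\}$ and $n_i\in\{0,1\}$ for $i\ge1$ (all but finitely many digits are $0$). -}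

module Defs where

open import Data.Nat using (ℕ; zero; suc; _+_; _*_; _∸_; _^_; _≤_; _<_; _≤?_; NonZero; >-nonZero; z<s)
open import Data.Nat.Properties using (m*n≢0; ≤-trans; m≤m+n; +-monoʳ-<)
open import Data.Nat.DivMod using (_/_; _%_)
open import Relation.Nullary using (yes; no)

fib : ℕ → ℕ
fib zero = 0
fib (suc zero) = 1
fib (suc (suc n)) = fib (suc n) + fib n

fib-pos : ∀ n → 0 < fib (suc n)
fib-pos zero = z<s
fib-pos (suc n) = ≤-trans (fib-pos n) (m≤m+n (fib (suc n)) (fib n))

fibFact : ℕ → ℕ
fibFact zero = 1
fibFact (suc n) = fib (suc n) * fibFact n

fibFact-nonZero : ∀ {n} → NonZero (fibFact n)
fibFact-nonZero {zero} = _
fibFact-nonZero {suc n} =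
  m*n≢0 (fib (suc n)) (fibFact n) {{>-nonZero (fib-pos n)}} {{fibFact-nonZero {n}}}

denom-nonZero : ∀ k m → NonZero (fibFact k * fibFact m)
denom-nonZero k m = m*n≢0 (fibFact k) (fibFact m) {{fibFact-nonZero {k}}} {{fibFact-nonZero {m}}}

fibBinom : ℕ → ℕ → ℕ
fibBinom n k with k ≤? n
... | yes _ = _/_ (fibFact n) (fibFact k * fibFact (n ∸ k)) {{denom-nonZero k (n ∸ k)}}
... | no _ = 0

baseF : ℕ → ℕ
baseF zero = 1
baseF (suc i) = 3 * 2 ^ i

baseF-nonZero : ∀ i → NonZero (baseF i)
baseF-nonZero zero = _
baseF-nonZero (suc i) = m*n≢0 3 (2 ^ i) {{_}} {{pow-nz i}}
  where
  pow-nz : ∀ i → NonZero (2 ^ i)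
  pow-nz zero = _
  pow-nz (suc i) = m*n≢0 2 (2 ^ i) {{_}} {{pow-nz i}}

-- Ratio b_{i+1} / b_i of consecutive bases: 3 for i = 0, 2 for i ≥ 1
-- (so that baseF (suc i) ≡ ratioF i * baseF i definitionally-by-cases)
ratioF : ℕ → ℕ
ratioF zero = 3
ratioF (suc i) = 2

ratioF-nonZero : ∀ i → NonZero (ratioF i)
ratioF-nonZero zero = _
ratioF-nonZero (suc i) = _

-- The i-th digit of n in base F: n_i = ⌊n / b_i⌋ mod (b_{i+1} / b_i),
-- so that n = Σ n_i b_i with 0 ≤ n_i < b_{i+1}/b_i
digitF : ℕ → ℕ → ℕ
digitF i n = _%_ (_/_ n (baseF i) {{baseF-nonZero i}}) (ratioF i) {{ratioF-nonZero i}}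

prodUpTo : ℕ → (ℕ → ℕ) → ℕ
prodUpTo zero f = 1
prodUpTo (suc N) f = prodUpTo N f * f N

module Submission where

-- Indexed as binom(a + b, a)_F, fibonomials obey a Pascal-type rule
-- whose weights F_{a+2} and F_b have 3-periodic parity (F_m is even iff 3 ∣ m).  A parity
-- array is determined by such a rule and its edges, and residue by residue one checks that
-- "the lowest base-3 digits of a and b add without carry, and binom(a/3 + b/3, a/3) is odd"
-- obeys the same rule; in the same way Pascal's triangle mod 2 is "no carry in the lowest
-- binary digit, and odd at the halves".  Read in (n, k) coordinates, "no carry" becomes
-- k_0 ≤ n_0, i.e. binom(n_0, k_0)_F odd, and iterating the binary step over the remaining
-- digits produces the product.

open import Data.Bool.Base using (if_then_else_)
open import Data.Fin using (Fin; zero; suc; toℕ; #_)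
open import Data.Fin.Properties using (toℕ<n)
open import Data.Nat.Base
open import Data.Nat.DivMod
open import Data.Nat.Divisibility using (n∣m*n)
open import Data.Nat.Properties
open import Data.Nat.Tactic.RingSolver using (solve-∀)
open import Data.Parity.Base as ℙ using (Parity; 0ℙ; 1ℙ)
import Data.Parity.Properties as ℙ
open import Data.Sum.Base using (inj₁; inj₂)
open import Function.Base using (_∘_)
open import Relation.Nullary.Decidable using (yes; no; does; dec-true; dec-false)
open import Relation.Nullary.Negation using (contradiction)
open import Relation.Binary.PropositionalEquality
open ≡-Reasoning

open import Defs

fib-suc-+ : ∀ m n → fib (suc (m + n)) ≡ fib (suc m) * fib (suc n) + fib m * fib n
fib-suc-+ zero          n = sym (trans (+-identityʳ _) (+-identityʳ _))
fib-suc-+ (suc zero)    n = sym (cong₂ _+_ (+-identityʳ (fib (suc n))) (+-identityʳ (fib n)))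
fib-suc-+ (suc (suc m)) n = begin
    fib (suc (suc m + n)) + fib (suc (m + n))
  ≡⟨ cong₂ _+_ (fib-suc-+ (suc m) n) (fib-suc-+ m n) ⟩
    (fib (2 + m) * fib (suc n) + fib (suc m) * fib n) + (fib (suc m) * fib (suc n) + fib m * fib n)
  ≡⟨ regroup (fib (2 + m)) (fib (suc m)) (fib m) (fib (suc n)) (fib n) ⟩
    (fib (2 + m) + fib (suc m)) * fib (suc n) + (fib (suc m) + fib m) * fib n
  ∎
  where
  regroup : ∀ a b c x y → (a * x + b * y) + (b * x + c * y) ≡ (a + b) * x + (b + c) * y
  regroup = solve-∀

parity-fib-+3 : ∀ n → parity (fib (3 + n)) ≡ parity (fib n)
parity-fib-+3 n = begin
  parity (fib (suc n) + fib n + fib (suc n))              ≡⟨ ℙ.+-homo-+ (fib (suc n) + fib n) _ ⟩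
  parity (fib (suc n) + fib n) ℙ.+ p                      ≡⟨ cong (ℙ._+ p) (ℙ.+-homo-+ (fib (suc n)) _) ⟩
  p ℙ.+ parity (fib n) ℙ.+ p                              ≡⟨ x+y+x≡y p _ ⟩
  parity (fib n)                                          ∎
  where
  p = parity (fib (suc n))
  x+y+x≡y : ∀ x y → x ℙ.+ y ℙ.+ x ≡ y
  x+y+x≡y 0ℙ 0ℙ = refl
  x+y+x≡y 0ℙ 1ℙ = refl
  x+y+x≡y 1ℙ 0ℙ = refl
  x+y+x≡y 1ℙ 1ℙ = refl

parity-fib-periodic : ∀ i s → parity (fib (i + s * 3)) ≡ parity (fib i)
parity-fib-periodic i zero    = cong (parity ∘ fib) (+-identityʳ i)
parity-fib-periodic i (suc s) = begin
  parity (fib (i + (3 + s * 3)))  ≡⟨ cong (parity ∘ fib) (i+[3+x]≡3+[i+x] (s * 3)) ⟩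
  parity (fib (3 + (i + s * 3)))  ≡⟨ parity-fib-+3 (i + s * 3) ⟩
  parity (fib (i + s * 3))        ≡⟨ parity-fib-periodic i s ⟩
  parity (fib i)                  ∎
  where
  i+[3+x]≡3+[i+x] : ∀ x → i + (3 + x) ≡ 3 + (i + x)
  i+[3+x]≡3+[i+x] x = trans (sym (+-assoc i 3 x)) (cong (_+ x) (+-comm i 3))

-- fibPascal a b = binom(a + b, a)_F; the rule comes from F_{a+b+2} = F_{a+2} F_{b+1} + F_{a+1} F_b.
fibPascal : ℕ → ℕ → ℕ
fibPascal zero    b       = 1
fibPascal (suc a) zero    = 1
fibPascal (suc a) (suc b) = fib (2 + a) * fibPascal (suc a) b + fib b * fibPascal a (suc b)

fibPascal-*-fibFact : ∀ a b → fibPascal a b * (fibFact a * fibFact b) ≡ fibFact (a + b)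
fibPascal-*-fibFact zero    b       = trans (*-identityˡ _) (*-identityˡ (fibFact b))
fibPascal-*-fibFact (suc a) zero    =
  trans (*-identityˡ _) (trans (*-identityʳ _) (cong fibFact (sym (+-identityʳ (suc a)))))
fibPascal-*-fibFact (suc a) (suc b) = begin
    (p * X + q * Y) * (u * fibFact a * (v * fibFact b))
  ≡⟨ distribute p q X Y u v (fibFact a) (fibFact b) ⟩
    p * v * (X * (u * fibFact a * fibFact b)) + q * u * (Y * (fibFact a * (v * fibFact b)))
  ≡⟨ cong₂ (λ x y → p * v * x + q * u * y)
           (fibPascal-*-fibFact (suc a) b) (fibPascal-*-fibFact a (suc b)) ⟩
    p * v * fibFact (suc (a + b)) + q * u * fibFact (a + suc b)
  ≡⟨ cong (λ m → p * v * fibFact (suc (a + b)) + q * u * fibFact m) (+-suc a b) ⟩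
    p * v * fibFact (suc (a + b)) + q * u * fibFact (suc (a + b))
  ≡⟨ factor p q u v (fibFact (suc (a + b))) ⟩
    (p * v + u * q) * fibFact (suc (a + b))
  ≡⟨ cong (_* fibFact (suc (a + b))) (sym (fib-suc-+ (suc a) b)) ⟩
    fibFact (suc (suc (a + b)))
  ≡⟨ cong (fibFact ∘ suc) (sym (+-suc a b)) ⟩
    fibFact (suc a + suc b)
  ∎
  where
  p = fib (2 + a); q = fib b; u = fib (suc a); v = fib (suc b)
  X = fibPascal (suc a) b; Y = fibPascal a (suc b)
  distribute : ∀ p q X Y u v x y →
    (p * X + q * Y) * (u * x * (v * y)) ≡ p * v * (X * (u * x * y)) + q * u * (Y * (x * (v * y)))
  distribute = solve-∀
  factor : ∀ p q u v z → p * v * z + q * u * z ≡ (p * v + u * q) * z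
  factor = solve-∀

fibFact/[fibFact*fibFact]≡fibPascal : ∀ {n k} → k ≤ n →
  _/_ (fibFact n) (fibFact k * fibFact (n ∸ k)) {{denom-nonZero k (n ∸ k)}} ≡ fibPascal k (n ∸ k)
fibFact/[fibFact*fibFact]≡fibPascal {n} {k} k≤n = begin
  fibFact n / denominator                          ≡⟨ /-congˡ (sym factorisation) ⟩
  fibPascal k (n ∸ k) * denominator / denominator  ≡⟨ m*n/n≡m (fibPascal k (n ∸ k)) denominator ⟩
  fibPascal k (n ∸ k)                              ∎
  where
  denominator = fibFact k * fibFact (n ∸ k)
  instance _ = denom-nonZero k (n ∸ k)
  factorisation : fibPascal k (n ∸ k) * denominator ≡ fibFact n
  factorisation = trans (fibPascal-*-fibFact k (n ∸ k)) (cong fibFact (m+[n∸m]≡n k≤n))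

record IsPascalArray (p q : ℕ → Parity) (G : ℕ → ℕ → Parity) : Set where
  field
    edgeˡ : ∀ b → G 0 b ≡ 1ℙ
    edgeʳ : ∀ a → G a 0 ≡ 1ℙ
    rule  : ∀ a b → G (suc a) (suc b) ≡ (p a ℙ.* G (suc a) b) ℙ.+ (q b ℙ.* G a (suc b))

open IsPascalArray

pascalArray-unique : ∀ {p q G H} → IsPascalArray p q G → IsPascalArray p q H →
  ∀ a b → G a b ≡ H a b
pascalArray-unique G H zero    b       = trans (edgeˡ G b) (sym (edgeˡ H b))
pascalArray-unique G H (suc a) zero    = trans (edgeʳ G (suc a)) (sym (edgeʳ H (suc a)))
pascalArray-unique {p} {q} G H (suc a) (suc b) = trans (rule G a b) (trans
  (cong₂ (λ x y → (p a ℙ.* x) ℙ.+ (q b ℙ.* y))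
         (pascalArray-unique G H (suc a) b) (pascalArray-unique G H a (suc b)))
  (sym (rule H a b)))

pascalParity : ℕ → ℕ → Parity
pascalParity zero    b       = 1ℙ
pascalParity (suc a) zero    = 1ℙ
pascalParity (suc a) (suc b) = pascalParity (suc a) b ℙ.+ pascalParity a (suc b)

pascalParity-isPascalArray : IsPascalArray (λ _ → 1ℙ) (λ _ → 1ℙ) pascalParity
pascalParity-isPascalArray = record
  { edgeˡ = λ _ → refl
  ; edgeʳ = λ { zero → refl ; (suc _) → refl }
  ; rule  = λ _ _ → refl
  }

parity-fibPascal-isPascalArray :
  IsPascalArray (λ a → parity (fib (2 + a))) (parity ∘ fib) (λ a b → parity (fibPascal a b))
parity-fibPascal-isPascalArray = record
  { edgeˡ = λ _ → refl
  ; edgeʳ = λ { zero → refl ; (suc _) → refl }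
  ; rule  = λ a b → let X = fibPascal (suc a) b; Y = fibPascal a (suc b) in
      trans (ℙ.+-homo-+ (fib (2 + a) * X) (fib b * Y))
            (cong₂ ℙ._+_ (ℙ.*-homo-* (fib (2 + a)) X) (ℙ.*-homo-* (fib b) Y))
  }

-- Opaque: unfolded, it would be normalised away before `rewrite noCarryThen-digits` can match it.
opaque
  noCarryThen : (r : ℕ) .{{_ : NonZero r}} → (ℕ → ℕ → Parity) → ℕ → ℕ → Parity
  noCarryThen r H a b = if does (a % r + b % r <? r) then H (a / r) (b / r) else 0ℙ

[i+s*r]%r≡i : ∀ {r} .{{_ : NonZero r}} {i} s → i < r → (i + s * r) % r ≡ i
[i+s*r]%r≡i {r} {i} s i<r = trans ([m+kn]%n≡m%n i s r) (m<n⇒m%n≡m i<r)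

[i+s*r]/r≡s : ∀ {r} .{{_ : NonZero r}} {i} s → i < r → (i + s * r) / r ≡ s
[i+s*r]/r≡s {r} {i} s i<r = begin
  (i + s * r) / r    ≡⟨ +-distrib-/-∣ʳ i (n∣m*n s) ⟩
  i / r + s * r / r  ≡⟨ cong₂ _+_ (m<n⇒m/n≡0 i<r) (m*n/n≡m s r) ⟩
  s                  ∎

opaque
  unfolding noCarryThen

  noCarryThen-digits : ∀ r .{{_ : NonZero r}} H (i j : Fin r) s t →
    noCarryThen r H (toℕ i + s * r) (toℕ j + t * r) ≡
    (if does (toℕ i + toℕ j <? r) then H s t else 0ℙ)
  noCarryThen-digits r H i j s t
    rewrite [i+s*r]%r≡i s (toℕ<n i) | [i+s*r]%r≡i t (toℕ<n j)
          | [i+s*r]/r≡s s (toℕ<n i) | [i+s*r]/r≡s t (toℕ<n j) = refl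

  noCarryThen-edgeˡ : ∀ r .{{_ : NonZero r}} {H} → (∀ b → H 0 b ≡ 1ℙ) →
    ∀ b → noCarryThen r H 0 b ≡ 1ℙ
  noCarryThen-edgeˡ (suc r) edge b rewrite dec-true (b % suc r <? suc r) (m%n<n b (suc r)) = edge _

  noCarryThen-edgeʳ : ∀ r .{{_ : NonZero r}} {H} → (∀ a → H a 0 ≡ 1ℙ) →
    ∀ a → noCarryThen r H a 0 ≡ 1ℙ
  noCarryThen-edgeʳ (suc r) edge a
    rewrite +-identityʳ (a % suc r) | dec-true (a % suc r <? suc r) (m%n<n a (suc r)) = edge _

noCarryThen₂-isPascalArray : IsPascalArray (λ _ → 1ℙ) (λ _ → 1ℙ) (noCarryThen 2 pascalParity)
noCarryThen₂-isPascalArray = record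
  { edgeˡ = noCarryThen-edgeˡ 2 (edgeˡ pascalParity-isPascalArray)
  ; edgeʳ = noCarryThen-edgeʳ 2 (edgeʳ pascalParity-isPascalArray)
  ; rule  = rule₂
  }
  where
  N = noCarryThen 2 pascalParity
  digits = noCarryThen-digits 2 pascalParity
  rule₂ : ∀ a b → N (suc a) (suc b) ≡ N (suc a) b ℙ.+ N a (suc b)
  rule₂ a b with a divMod 2 | b divMod 2
  ... | result s zero refl | result t zero refl
    rewrite digits (# 1) (# 1) s t | digits (# 1) (# 0) s t | digits (# 0) (# 1) s t
    = sym (ℙ.p+p≡0ℙ (pascalParity s t))
  ... | result s zero refl | result t (suc zero) refl
    rewrite digits (# 1) (# 0) s (suc t) | digits (# 1) (# 1) s t | digits (# 0) (# 0) s (suc t)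
    = refl
  ... | result s (suc zero) refl | result t zero refl
    rewrite digits (# 0) (# 1) (suc s) t | digits (# 0) (# 0) (suc s) t | digits (# 1) (# 1) s t
    = sym (ℙ.+-identityʳ _)
  ... | result s (suc zero) refl | result t (suc zero) refl
    rewrite digits (# 0) (# 0) (suc s) (suc t) | digits (# 0) (# 1) (suc s) t | digits (# 1) (# 0) s (suc t)
    = refl

noCarryThen₃-isPascalArray :
  IsPascalArray (λ a → parity (fib (2 + a))) (parity ∘ fib) (noCarryThen 3 pascalParity)
noCarryThen₃-isPascalArray = record
  { edgeˡ = noCarryThen-edgeˡ 3 (edgeˡ pascalParity-isPascalArray)
  ; edgeʳ = noCarryThen-edgeʳ 3 (edgeʳ pascalParity-isPascalArray)
  ; rule  = rule₃
  }
  where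
  N = noCarryThen 3 pascalParity
  digits = noCarryThen-digits 3 pascalParity
  rule₃ : ∀ a b →
    N (suc a) (suc b) ≡ (parity (fib (2 + a)) ℙ.* N (suc a) b) ℙ.+ (parity (fib b) ℙ.* N a (suc b))
  -- With a = i + 3s and b = j + 3t, each case is Pascal's rule for pascalParity at (s, t),
  -- or p + p = 0, or p + 0 = p.
  rule₃ a b with a divMod 3 | b divMod 3
  ... | result s zero refl | result t zero refl
    rewrite parity-fib-periodic 2 s | parity-fib-periodic 0 t
          | digits (# 1) (# 1) s t | digits (# 1) (# 0) s t
    = sym (ℙ.+-identityʳ _)
  ... | result s zero refl | result t (suc zero) refl
    rewrite parity-fib-periodic 2 s | parity-fib-periodic 1 t
          | digits (# 1) (# 2) s t | digits (# 1) (# 1) s t | digits (# 0) (# 2) s t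
    = sym (ℙ.p+p≡0ℙ (pascalParity s t))
  ... | result s zero refl | result t (suc (suc zero)) refl
    rewrite parity-fib-periodic 2 s | parity-fib-periodic 2 t
          | digits (# 1) (# 0) s (suc t) | digits (# 1) (# 2) s t | digits (# 0) (# 0) s (suc t)
    = refl
  ... | result s (suc zero) refl | result t zero refl
    rewrite parity-fib-periodic 3 s | parity-fib-periodic 0 t
          | digits (# 2) (# 1) s t
    = refl
  ... | result s (suc zero) refl | result t (suc zero) refl
    rewrite parity-fib-periodic 3 s | parity-fib-periodic 1 t
          | digits (# 2) (# 2) s t | digits (# 1) (# 2) s t
    = refl
  ... | result s (suc zero) refl | result t (suc (suc zero)) refl
    rewrite parity-fib-periodic 3 s | parity-fib-periodic 2 t
          | digits (# 2) (# 0) s (suc t) | digits (# 1) (# 0) s (suc t)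
    = refl
  ... | result s (suc (suc zero)) refl | result t zero refl
    rewrite parity-fib-periodic 4 s | parity-fib-periodic 0 t
          | digits (# 0) (# 1) (suc s) t | digits (# 0) (# 0) (suc s) t
    = sym (ℙ.+-identityʳ _)
  ... | result s (suc (suc zero)) refl | result t (suc zero) refl
    rewrite parity-fib-periodic 4 s | parity-fib-periodic 1 t
          | digits (# 0) (# 2) (suc s) t | digits (# 0) (# 1) (suc s) t | digits (# 2) (# 2) s t
    = sym (ℙ.+-identityʳ _)
  ... | result s (suc (suc zero)) refl | result t (suc (suc zero)) refl
    rewrite parity-fib-periodic 4 s | parity-fib-periodic 2 t
          | digits (# 0) (# 0) (suc s) (suc t) | digits (# 0) (# 2) (suc s) t | digits (# 2) (# 0) s (suc t)
    = refl

triangle : (ℕ → ℕ → Parity) → ℕ → ℕ → Parity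
triangle G n k with k ≤? n
... | yes _ = G k (n ∸ k)
... | no  _ = 0ℙ

triangle-cong : ∀ {G H} → (∀ a b → G a b ≡ H a b) → ∀ n k → triangle G n k ≡ triangle H n k
triangle-cong G≗H n k with k ≤? n
... | yes _ = G≗H k (n ∸ k)
... | no  _ = refl

triangle-+ : ∀ G a b → triangle G (a + b) a ≡ G a b
triangle-+ G a b with a ≤? a + b
... | yes _    = cong (G a) (m+n∸m≡n a b)
... | no  a≰a+b = contradiction (m≤m+n a b) a≰a+b

triangle-< : ∀ G {n k} → n < k → triangle G n k ≡ 0ℙ
triangle-< G {n} {k} n<k with k ≤? n
... | yes k≤n = contradiction k≤n (<⇒≱ n<k)
... | no  _   = refl

parity-fibBinom : ∀ n k → parity (fibBinom n k) ≡ triangle (λ a b → parity (fibPascal a b)) n k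
parity-fibBinom n k with k ≤? n
... | yes k≤n = cong parity (fibFact/[fibFact*fibFact]≡fibPascal k≤n)
... | no  _   = refl

module _ {r} .{{_ : NonZero r}} {a b : ℕ} where

  [a+b]%r-noCarry : a % r + b % r < r → (a + b) % r ≡ a % r + b % r
  [a+b]%r-noCarry no-carry = trans (%-distribˡ-+ a b r) (m<n⇒m%n≡m no-carry)

  [a+b]%r-carry : r ≤ a % r + b % r → (a + b) % r < a % r
  [a+b]%r-carry carry = subst (_< a % r) (sym wraps) wrapped
    where
    wrapped : a % r + b % r ∸ r < a % r
    wrapped = subst (a % r + b % r ∸ r <_) (m+n∸n≡m (a % r) r)
                    (∸-monoˡ-< (+-monoʳ-< (a % r) (m%n<n b r)) carry)
    wraps : (a + b) % r ≡ a % r + b % r ∸ r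
    wraps = begin
      (a + b) % r              ≡⟨ %-distribˡ-+ a b r ⟩
      (a % r + b % r) % r      ≡⟨ m≤n⇒[n∸m]%m≡n%m carry ⟨
      (a % r + b % r ∸ r) % r  ≡⟨ m<n⇒m%n≡m (<-trans wrapped (m%n<n a r)) ⟩
      a % r + b % r ∸ r        ∎

%≤%∧/≤/⇒≤ : ∀ {r} .{{_ : NonZero r}} {k n} → k % r ≤ n % r → k / r ≤ n / r → k ≤ n
%≤%∧/≤/⇒≤ {r} {k} {n} low high = subst₂ _≤_ (sym (m≡m%n+[m/n]*n k r)) (sym (m≡m%n+[m/n]*n n r))
  (+-mono-≤ low (*-monoˡ-≤ r high))

opaque
  unfolding noCarryThen

  noCarryThen-triangles : ∀ r .{{_ : NonZero r}} H a b → noCarryThen r H a b ≡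
    triangle (λ _ _ → 1ℙ) ((a + b) % r) (a % r) ℙ.* triangle H ((a + b) / r) (a / r)
  noCarryThen-triangles r H a b with <-≤-connex (a % r + b % r) r
  ... | inj₁ no-carry rewrite dec-true (a % r + b % r <? r) no-carry = sym (cong₂ ℙ._*_ low high)
    where
    low : triangle (λ _ _ → 1ℙ) ((a + b) % r) (a % r) ≡ 1ℙ
    low = trans (cong (λ m → triangle _ m (a % r)) ([a+b]%r-noCarry no-carry))
                (triangle-+ _ (a % r) (b % r))
    high : triangle H ((a + b) / r) (a / r) ≡ H (a / r) (b / r)
    high = trans (cong (λ m → triangle H m (a / r)) (+-distrib-/ a b no-carry))
                 (triangle-+ H (a / r) (b / r))
  ... | inj₂ carry rewrite dec-false (a % r + b % r <? r) (≤⇒≯ carry) =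
    sym (cong (ℙ._* triangle H ((a + b) / r) (a / r))
              (triangle-< (λ _ _ → 1ℙ) ([a+b]%r-carry carry)))

triangle-noCarryThen : ∀ r .{{_ : NonZero r}} H n k → triangle (noCarryThen r H) n k ≡
  triangle (λ _ _ → 1ℙ) (n % r) (k % r) ℙ.* triangle H (n / r) (k / r)
triangle-noCarryThen r H n k with k ≤? n
... | yes k≤n = trans (noCarryThen-triangles r H k (n ∸ k))
  (cong (λ m → triangle (λ _ _ → 1ℙ) (m % r) (k % r) ℙ.* triangle H (m / r) (k / r))
        (m+[n∸m]≡n k≤n))
... | no k≰n with k % r ≤? n % r
...   | yes low = sym (triangle-< H (≰⇒> (k≰n ∘ %≤%∧/≤/⇒≤ low)))
...   | no  _   = refl

parity-fibBinom-lucas : ∀ n k → parity (fibBinom n k) ≡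
  triangle (λ _ _ → 1ℙ) (n % 3) (k % 3) ℙ.* triangle pascalParity (n / 3) (k / 3)
parity-fibBinom-lucas n k = begin
  parity (fibBinom n k)                          ≡⟨ parity-fibBinom n k ⟩
  triangle (λ a b → parity (fibPascal a b)) n k  ≡⟨ triangle-cong fibPascal≗noCarryThen n k ⟩
  triangle (noCarryThen 3 pascalParity) n k      ≡⟨ triangle-noCarryThen 3 pascalParity n k ⟩
  _                                              ∎
  where
  fibPascal≗noCarryThen = pascalArray-unique parity-fibPascal-isPascalArray noCarryThen₃-isPascalArray

pascalParity-lucas : ∀ n k → triangle pascalParity n k ≡
  triangle (λ _ _ → 1ℙ) (n % 2) (k % 2) ℙ.* triangle pascalParity (n / 2) (k / 2)
pascalParity-lucas n k = trans
  (triangle-cong (pascalArray-unique pascalParity-isPascalArray noCarryThen₂-isPascalArray) n k)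
  (triangle-noCarryThen 2 pascalParity n k)

parity-fibBinom-digits : ∀ {i j} → i < 3 → j < 3 →
  parity (fibBinom i j) ≡ triangle (λ _ _ → 1ℙ) i j
parity-fibBinom-digits {0} {0} _ _ = refl
parity-fibBinom-digits {0} {1} _ _ = refl
parity-fibBinom-digits {0} {2} _ _ = refl
parity-fibBinom-digits {1} {0} _ _ = refl
parity-fibBinom-digits {1} {1} _ _ = refl
parity-fibBinom-digits {1} {2} _ _ = refl
parity-fibBinom-digits {2} {0} _ _ = refl
parity-fibBinom-digits {2} {1} _ _ = refl
parity-fibBinom-digits {2} {2} _ _ = refl
parity-fibBinom-digits {suc (suc (suc _))} (s≤s (s≤s (s≤s ()))) _
parity-fibBinom-digits {_} {suc (suc (suc _))} _ (s≤s (s≤s (s≤s ())))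

prodUpTo-suc : ∀ N f → prodUpTo (suc N) f ≡ f 0 * prodUpTo N (f ∘ suc)
prodUpTo-suc zero    f = *-comm 1 (f 0)
prodUpTo-suc (suc N) f = begin
  prodUpTo (suc N) f * f (suc N)              ≡⟨ cong (_* f (suc N)) (prodUpTo-suc N f) ⟩
  f 0 * prodUpTo N (f ∘ suc) * f (suc N)      ≡⟨ *-assoc (f 0) _ _ ⟩
  f 0 * (prodUpTo N (f ∘ suc) * f (suc N))    ∎

prodUpTo-cong : ∀ N {f g} → (∀ i → f i ≡ g i) → prodUpTo N f ≡ prodUpTo N g
prodUpTo-cong zero    f≗g = refl
prodUpTo-cong (suc N) f≗g = cong₂ _*_ (prodUpTo-cong N f≗g) (f≗g N)

bit : ℕ → ℕ → ℕ
bit zero    x = x % 2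
bit (suc i) x = bit i (x / 2)

pascalParity-bits : ∀ M {x y} → x < 2 ^ M → y < 2 ^ M →
  triangle pascalParity x y ≡ parity (prodUpTo M (λ i → fibBinom (bit i x) (bit i y)))
pascalParity-bits zero (s≤s z≤n) (s≤s z≤n) = refl
pascalParity-bits (suc M) {x} {y} x<2^M y<2^M = begin
  triangle pascalParity x y
    ≡⟨ pascalParity-lucas x y ⟩
  triangle (λ _ _ → 1ℙ) (x % 2) (y % 2) ℙ.* triangle pascalParity (x / 2) (y / 2)
    ≡⟨ cong₂ ℙ._*_ (sym (parity-fibBinom-digits (bit<3 x) (bit<3 y)))
                   (pascalParity-bits M (halve x<2^M) (halve y<2^M)) ⟩
  parity (fibBinom (x % 2) (y % 2))
    ℙ.* parity (prodUpTo M (λ i → fibBinom (bit i (x / 2)) (bit i (y / 2))))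
    ≡⟨ ℙ.*-homo-* (fibBinom (x % 2) (y % 2)) _ ⟨
  parity (fibBinom (x % 2) (y % 2) * prodUpTo M (λ i → fibBinom (bit i (x / 2)) (bit i (y / 2))))
    ≡⟨ cong parity (prodUpTo-suc M (λ i → fibBinom (bit i x) (bit i y))) ⟨
  parity (prodUpTo (suc M) (λ i → fibBinom (bit i x) (bit i y)))
    ∎
  where
  bit<3 : ∀ z → z % 2 < 3
  bit<3 z = m<n⇒m<1+n (m%n<n z 2)
  halve : ∀ {z} → z < 2 ^ suc M → z / 2 < 2 ^ M
  halve {z} z< = m<n*o⇒m/o<n (subst (z <_) (*-comm 2 (2 ^ M)) z<)

/2^%2≡bit : ∀ i x → _/_ x (2 ^ i) {{m^n≢0 2 i}} % 2 ≡ bit i x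
/2^%2≡bit zero    x = cong (_% 2) (n/1≡n x)
/2^%2≡bit (suc i) x = trans
  (cong (_% 2) (sym (m/n/o≡m/[n*o] x 2 (2 ^ i) {{_}} {{m^n≢0 2 i}} {{m^n≢0 2 (suc i)}})))
  (/2^%2≡bit i (x / 2))

digitF-zero : ∀ n → digitF 0 n ≡ n % 3
digitF-zero n = cong (_% 3) (n/1≡n n)

digitF-suc : ∀ i n → digitF (suc i) n ≡ bit i (n / 3)
digitF-suc i n = trans
  (cong (_% 2) (sym (m/n/o≡m/[n*o] n 3 (2 ^ i) {{_}} {{m^n≢0 2 i}} {{baseF-nonZero (suc i)}})))
  (/2^%2≡bit i (n / 3))

prodUpTo-digitF : ∀ N n k → prodUpTo (suc N) (λ i → fibBinom (digitF i n) (digitF i k)) ≡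
  fibBinom (n % 3) (k % 3) * prodUpTo N (λ i → fibBinom (bit i (n / 3)) (bit i (k / 3)))
prodUpTo-digitF N n k = trans (prodUpTo-suc N _) (cong₂ _*_
  (cong₂ fibBinom (digitF-zero n) (digitF-zero k))
  (prodUpTo-cong N (λ i → cong₂ fibBinom (digitF-suc i n) (digitF-suc i k))))

≡-parity⇒≡-%2 : ∀ m n → parity m ≡ parity n → m % 2 ≡ n % 2
≡-parity⇒≡-%2 m n eq = trans (%2≡⟦parity⟧ m) (trans (cong ⟦_⟧ eq) (sym (%2≡⟦parity⟧ n)))
  where
  ⟦_⟧ : Parity → ℕ
  ⟦ 0ℙ ⟧ = 0
  ⟦ 1ℙ ⟧ = 1
  %2≡⟦parity⟧ : ∀ n → n % 2 ≡ ⟦ parity n ⟧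
  %2≡⟦parity⟧ zero          = refl
  %2≡⟦parity⟧ (suc zero)    = refl
  %2≡⟦parity⟧ (suc (suc n)) = %2≡⟦parity⟧ n

theorem3p4 : (n k N : ℕ) → n < baseF N → k < baseF N →
    fibBinom n k % 2 ≡ prodUpTo N (λ i → fibBinom (digitF i n) (digitF i k)) % 2
theorem3p4 n k zero    (s≤s z≤n) (s≤s z≤n) = refl
theorem3p4 n k (suc N) n<b k<b =
  ≡-parity⇒≡-%2 (fibBinom n k) (prodUpTo (suc N) digitProduct) (begin
  parity (fibBinom n k)
    ≡⟨ parity-fibBinom-lucas n k ⟩
  triangle (λ _ _ → 1ℙ) (n % 3) (k % 3) ℙ.* triangle pascalParity (n / 3) (k / 3)
    ≡⟨ cong₂ ℙ._*_ (sym (parity-fibBinom-digits (m%n<n n 3) (m%n<n k 3)))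
                   (pascalParity-bits N (/3< n<b) (/3< k<b)) ⟩
  parity (fibBinom (n % 3) (k % 3))
    ℙ.* parity (prodUpTo N (λ i → fibBinom (bit i (n / 3)) (bit i (k / 3))))
    ≡⟨ ℙ.*-homo-* (fibBinom (n % 3) (k % 3)) _ ⟨
  parity (fibBinom (n % 3) (k % 3) * prodUpTo N (λ i → fibBinom (bit i (n / 3)) (bit i (k / 3))))
    ≡⟨ cong parity (prodUpTo-digitF N n k) ⟨
  parity (prodUpTo (suc N) digitProduct)
    ∎)
  where
  digitProduct = λ i → fibBinom (digitF i n) (digitF i k)
  /3< : ∀ {m} → m < baseF (suc N) → m / 3 < 2 ^ N
  /3< {m} m< = m<n*o⇒m/o<n (subst (m <_) (*-comm 3 (2 ^ N)) m<)
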